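{- Let $v\in\mathcal L(\psi(\mathbf p))$ be a bispecial factor of $\psi(\mathbf p)$ that contains $11001$ or $1101$ as a factor. Then one of the following holds: (1) there exists $w\in\mathcal L(\mathbf p)$ with $v=01\psi(w)0110$ and $0w,2w,w0,w2\in\mathcal L(\mathbf p)$; (2) there exists $w\in\mathcal L(\mathbf p)$ with $v=\psi(w)0$ and $0w,1w,w1,w2\in\mathcal L(\mathbf p)$; (3) there exists $w\in\mathcal L(\mathbf p)$ with $v=01\psi(w)0$ and $0w,2w,w1,w2\in\mathcal L(\mathbf p)$; (4) there exists $w\in\mathcal L(\mathbf p)$ with $v=\psi(w)0110$ and $0w,1w,w0,w2\in\mathcal L(\mathbf p)$.
   Context: $\mathbf p$ is the infinite fixed point of the morphism $\varphi$ on $\{0,1,2\}^*$ with $\varphi(0)=01$, $\varphi(1)=21$, $\varphi(2)=0$. $\psi$ is the morphism $\psi(0)=011001$, $\psi(1)=0$, $\psi(2)=01101$. $\mathcal L(\mathbf u)$ is the set of finite factors of $\mathbf u$; a factor $v$ is bispecial if it has two distinct left extensions $av,bv$ and two distinct right extensions $vc,vd$ in $\mathcal L(\mathbf u)$. -}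

module Defs where

open import Data.Nat using (ℕ; zero; suc)
open import Data.Fin using (Fin; zero; suc)
open import Data.List using (List; []; _∷_; _++_; concatMap; [_])
open import Data.Product using (Σ; ∃; ∃-syntax; _×_; _,_)
open import Relation.Binary.PropositionalEquality using (_≡_; _≢_)

T3 : Set
T3 = Fin 3

B2 : Set
B2 = Fin 2

t0 t1 t2 : T3
t0 = zero
t1 = suc zero
t2 = suc (suc zero)

b0 b1 : B2
b0 = zero
b1 = suc zero

φ₁ : T3 → List T3
φ₁ zero = t0 ∷ t1 ∷ []
φ₁ (suc zero) = t2 ∷ t1 ∷ []
φ₁ (suc (suc zero)) = t0 ∷ []

φ : List T3 → List T3
φ = concatMap φ₁

ψ₁ : T3 → List B2
ψ₁ zero = b0 ∷ b1 ∷ b1 ∷ b0 ∷ b0 ∷ b1 ∷ []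
ψ₁ (suc zero) = b0 ∷ []
ψ₁ (suc (suc zero)) = b0 ∷ b1 ∷ b1 ∷ b0 ∷ b1 ∷ []

ψ : List T3 → List B2
ψ = concatMap ψ₁

-- φ^n(0): the prefixes of the fixed point p = lim φ^n(0)
φ^ : ℕ → List T3 → List T3
φ^ zero u = u
φ^ (suc n) u = φ (φ^ n u)

pPrefix : ℕ → List T3
pPrefix n = φ^ n (t0 ∷ [])

Factor : {A : Set} → List A → List A → Set
Factor u x = ∃[ l ] ∃[ r ] (x ≡ l ++ u ++ r)

-- L(p): factors of the fixed point p (every factor of p lies in some prefix φ^n(0))
Lp : List T3 → Set
Lp u = ∃[ n ] Factor u (pPrefix n)

-- L(ψ(p)): factors of ψ(p) (every factor of ψ(p) lies in some ψ(φ^n(0)))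
Lψp : List B2 → Set
Lψp u = ∃[ n ] Factor u (ψ (pPrefix n))

BispecialΨp : List B2 → Set
BispecialΨp v =
  (∃[ a ] ∃[ b ] (a ≢ b × Lψp (a ∷ v) × Lψp (b ∷ v))) ×
  (∃[ c ] ∃[ d ] (c ≢ d × Lψp (v ++ [ c ]) × Lψp (v ++ [ d ])))

w01 w0 w0110 w11001 w1101 : List B2
w01 = b0 ∷ b1 ∷ []
w0 = b0 ∷ []
w0110 = b0 ∷ b1 ∷ b1 ∷ b0 ∷ []
w11001 = b1 ∷ b1 ∷ b0 ∷ b0 ∷ b1 ∷ []
w1101 = b1 ∷ b1 ∷ b0 ∷ b1 ∷ []

-- Every block ψ(a) starts with 0. Hence two readings of the same word as s ψ(w) e, with s a proper
-- suffix and e a proper prefix of a block, can only place the block boundaries differently when one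
-- cut overshoots the other by 01 or 001 and the word is itself a block suffix; the block suffixes
-- of that form (01, 001, 101, 1001) contain neither 11001 nor 1101. So all occurrences of v in ψ(p) share the cut s, and (w, e) is unique up to
-- trading a final block ψ(1) = 0 against e = 0. Reading off the blocks around the occurrences of
-- 0v, 1v, v0 and v1 leaves only s ∈ {ε, 01} and e ∈ {0, 0110} with the extensions of w claimed by
-- the theorem; the other combinations are excluded by the two-letter factors of p (1 and 2 have no
-- common successor, 0 and 1 no common predecessor).
module Submission where

open import Defs
open import Data.Empty using (⊥; ⊥-elim)
open import Data.Fin using (zero; suc)
open import Data.Fin.Properties using (_≟_)
open import Data.List using (List; []; _∷_; _++_; [_]; _∷ʳ_; initLast; _∷ʳ′_)
open import Data.List.Properties
  using (concatMap-++; ++-assoc; ++-identityʳ; ++-cancelˡ; ∷-injective; ∷-injectiveʳ; ∷ʳ-++;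
         ++-conicalˡ; ++-conicalʳ; ++-monoid)
open import Data.List.Relation.Binary.Infix.Heterogeneous using (Infix; MkView; fromView)
open import Data.List.Relation.Binary.Infix.Heterogeneous.Properties using (infix?)
open import Data.List.Relation.Binary.Pointwise using (≡⇒Pointwise-≡)
open import Data.List.Relation.Unary.Linked using (Linked; []; [-]; _∷_; head; tail)
open import Data.Nat using (zero; suc; _+_)
open import Data.Product using (∃-syntax; _×_; _,_; proj₁; proj₂)
open import Data.Sum using (_⊎_; inj₁; inj₂; [_,_]′)
open import Relation.Nullary using (¬_)
open import Relation.Nullary.Decidable using (False; toWitnessFalse)
open import Relation.Binary.PropositionalEquality
  using (_≡_; _≢_; refl; sym; trans; cong; subst; module ≡-Reasoning)

ψ-++ : ∀ u u′ → ψ (u ++ u′) ≡ ψ u ++ ψ u′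
ψ-++ = concatMap-++ ψ₁

φ^-++ : ∀ k u u′ → φ^ k (u ++ u′) ≡ φ^ k u ++ φ^ k u′
φ^-++ zero    u u′ = refl
φ^-++ (suc k) u u′ = trans (cong φ (φ^-++ k u u′)) (concatMap-++ φ₁ (φ^ k u) (φ^ k u′))

φ^-suc : ∀ k u → φ^ (suc k) u ≡ φ^ k (φ u)
φ^-suc zero    u = refl
φ^-suc (suc k) u = cong φ (φ^-suc k u)

φ-≢[] : ∀ {u} → u ≢ [] → φ u ≢ []
φ-≢[] {[]}                 u≢[] _ = u≢[] refl
φ-≢[] {zero ∷ _}           _ ()
φ-≢[] {suc zero ∷ _}       _ ()
φ-≢[] {suc (suc zero) ∷ _} _ ()

φ^-≢[] : ∀ k {u} → u ≢ [] → φ^ k u ≢ []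
φ^-≢[] zero    u≢[] = u≢[]
φ^-≢[] (suc k) u≢[] = φ-≢[] (φ^-≢[] k u≢[])

ψ-≢[] : ∀ {u} → u ≢ [] → ψ u ≢ []
ψ-≢[] {[]}                 u≢[] _ = u≢[] refl
ψ-≢[] {zero ∷ _}           _ ()
ψ-≢[] {suc zero ∷ _}       _ ()
ψ-≢[] {suc (suc zero) ∷ _} _ ()

ψ-++-≡[] : ∀ w e → ψ w ++ e ≡ [] → w ≡ [] × e ≡ []
ψ-++-≡[] []                  e eq = refl , eq
ψ-++-≡[] (zero ∷ _)          _ ()
ψ-++-≡[] (suc zero ∷ _)      _ ()
ψ-++-≡[] (suc (suc zero) ∷ _) _ ()

-- φ³(0) = 0121021 and φ(2) = 0, so φⁿ⁺³(0) = φⁿ⁺¹(0) φⁿ⁺¹(1) φⁿ(0) φⁿ⁺¹(1).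
pPrefix-flanked : ∀ n → ∃[ α ] ∃[ β ] (α ≢ [] × β ≢ [] × pPrefix (3 + n) ≡ α ++ pPrefix n ++ β)
pPrefix-flanked n = Y t0 ++ Y t1 , Y t1 , α≢[] , φ^-≢[] (suc n) (λ ()) , decomposition
  where
    Y : T3 → List T3
    Y c = φ^ (suc n) [ c ]

    α≢[] : Y t0 ++ Y t1 ≢ []
    α≢[] eq = φ^-≢[] (suc n) (λ ()) (++-conicalˡ (Y t0) (Y t1) eq)

    open ≡-Reasoning

    decomposition : pPrefix (3 + n) ≡ (Y t0 ++ Y t1) ++ pPrefix n ++ Y t1
    decomposition = begin
      φ^ (3 + n) [ t0 ]                          ≡⟨ trans (φ^-suc (2 + n) _) (φ^-suc (suc n) _) ⟩
      φ^ (suc n) (t0 ∷ t1 ∷ t2 ∷ t1 ∷ [])        ≡⟨ φ^-++ (suc n) [ t0 ] _ ⟩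
      Y t0 ++ φ^ (suc n) (t1 ∷ t2 ∷ t1 ∷ [])     ≡⟨ cong (Y t0 ++_) (φ^-++ (suc n) [ t1 ] _) ⟩
      Y t0 ++ Y t1 ++ φ^ (suc n) (t2 ∷ t1 ∷ [])  ≡⟨ cong (λ z → Y t0 ++ Y t1 ++ z) (φ^-++ (suc n) [ t2 ] _) ⟩
      Y t0 ++ Y t1 ++ Y t2 ++ Y t1               ≡⟨ cong (λ z → Y t0 ++ Y t1 ++ z ++ Y t1) (φ^-suc n [ t2 ]) ⟩
      Y t0 ++ Y t1 ++ pPrefix n ++ Y t1          ≡⟨ sym (++-assoc (Y t0) (Y t1) _) ⟩
      (Y t0 ++ Y t1) ++ pPrefix n ++ Y t1        ∎

Factor-refl : ∀ {A : Set} (u : List A) → Factor u u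
Factor-refl u = [] , [] , sym (++-identityʳ u)

Factor-trans : ∀ {A : Set} {u v x : List A} → Factor u v → Factor v x → Factor u x
Factor-trans {A} {u} (l , r , refl) (l′ , r′ , refl) = l′ ++ l , r ++ r′ , regroup
  where
    open import Algebra.Solver.Monoid (++-monoid A)
    regroup : l′ ++ (l ++ u ++ r) ++ r′ ≡ (l′ ++ l) ++ u ++ r ++ r′
    regroup = solve 5 (λ l′ l u r r′ → l′ ⊕ ((l ⊕ (u ⊕ r)) ⊕ r′) ⊜ (l′ ⊕ l) ⊕ (u ⊕ (r ⊕ r′))) refl
                l′ l u r r′

Factor-prefix : ∀ {A : Set} (u r : List A) → Factor u (u ++ r)
Factor-prefix u r = [] , r , refl

Factor-suffix : ∀ {A : Set} (l u : List A) → Factor u (l ++ u)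
Factor-suffix l u = l , [] , cong (l ++_) (sym (++-identityʳ u))

Factor-extendʳ : ∀ {A : Set} {u v : List A} z k → Factor u v → ∃[ c ] Factor (u ++ [ c ]) (v ++ z ∷ k)
Factor-extendʳ {A} {u} z k (l , [] , refl) = z , l , k , regroup
  where
    open import Algebra.Solver.Monoid (++-monoid A)
    regroup : (l ++ u ++ []) ++ z ∷ k ≡ l ++ (u ++ [ z ]) ++ k
    regroup = solve 4 (λ l u z k → (l ⊕ (u ⊕ id)) ⊕ (z ⊕ k) ⊜ l ⊕ ((u ⊕ z) ⊕ k)) refl l u [ z ] k
Factor-extendʳ {A} {u} z k (l , c ∷ r , refl) = c , l , r ++ z ∷ k , regroup
  where
    open import Algebra.Solver.Monoid (++-monoid A)
    regroup : (l ++ u ++ c ∷ r) ++ z ∷ k ≡ l ++ (u ++ [ c ]) ++ r ++ z ∷ k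
    regroup = solve 5 (λ l u c r zk → (l ⊕ (u ⊕ (c ⊕ r))) ⊕ zk ⊜ l ⊕ ((u ⊕ c) ⊕ (r ⊕ zk))) refl
                l u [ c ] r (z ∷ k)

Lp-factor : ∀ {u u′} → Factor u′ u → Lp u → Lp u′
Lp-factor f (n , g) = n , Factor-trans f g

Lp-prefix : ∀ u r → Lp (u ++ r) → Lp u
Lp-prefix u r = Lp-factor (Factor-prefix u r)

Lp-suffix : ∀ l u → Lp (l ++ u) → Lp u
Lp-suffix l u = Lp-factor (Factor-suffix l u)

MarkerIn : List B2 → Set
MarkerIn v = Factor w11001 v ⊎ Factor w1101 v

Factor⇒Infix : ∀ {u x : List B2} → Factor u x → Infix _≡_ u x
Factor⇒Infix (l , r , refl) = fromView (MkView l (≡⇒Pointwise-≡ refl) r)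

notFactor : (u x : List B2) {_ : False (infix? _≟_ u x)} → ¬ Factor u x
notFactor u x {nf} f = toWitnessFalse nf (Factor⇒Infix f)

markerFree : (v : List B2) {_ : False (infix? _≟_ w11001 v)} {_ : False (infix? _≟_ w1101 v)} →
  ¬ MarkerIn v
markerFree v {p} {q} = [ notFactor w11001 v {p} , notFactor w1101 v {q} ]′

++-align : ∀ {A : Set} (a b c d : List A) → a ++ b ≡ c ++ d →
  (∃[ k ] (c ≡ a ++ k × b ≡ k ++ d)) ⊎ (∃[ z ] ∃[ k ] (a ≡ c ++ z ∷ k × d ≡ z ∷ k ++ b))
++-align []      b c       d eq = inj₁ (c , refl , eq)
++-align (x ∷ a) b []      d eq = inj₂ (x , a , refl , sym eq)
++-align (x ∷ a) b (y ∷ c) d eq with ∷-injective eq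
... | refl , eq′ with ++-align a b c d eq′
...   | inj₁ (k , refl , b≡)     = inj₁ (k , refl , b≡)
...   | inj₂ (z , k , refl , d≡) = inj₂ (z , k , refl , d≡)

flanked : ∀ {A : Set} {x α u β : List A} → x ≡ α ++ u ++ β → α ≢ [] → β ≢ [] →
  ∃[ l ] ∃[ c ] ∃[ d ] ∃[ r ] (x ≡ l ++ c ∷ u ++ d ∷ r)
flanked {α = α} {u} {β} x≡ α≢[] β≢[] with initLast α | β
... | []      | _     = ⊥-elim (α≢[] refl)
... | _ ∷ʳ′ _ | []    = ⊥-elim (β≢[] refl)
... | l ∷ʳ′ c | d ∷ r = l , c , d , r , trans x≡ (∷ʳ-++ l c (u ++ d ∷ r))

Lψp-flanked : ∀ {u} → Lψp u →
  ∃[ xs ] (Lp xs × ∃[ l ] ∃[ c ] ∃[ d ] ∃[ r ] (ψ xs ≡ l ++ c ∷ u ++ d ∷ r))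
Lψp-flanked {u} (n , L , R , eq) with pPrefix-flanked n
... | α , β , α≢[] , β≢[] , split =
      pPrefix (3 + n) , (3 + n , Factor-refl _) , flanked decomposition ψα++L≢[] R++ψβ≢[]
  where
    ψα++L≢[] : ψ α ++ L ≢ []
    ψα++L≢[] e = ψ-≢[] α≢[] (++-conicalˡ (ψ α) L e)

    R++ψβ≢[] : R ++ ψ β ≢ []
    R++ψβ≢[] e = ψ-≢[] β≢[] (++-conicalʳ R (ψ β) e)

    open import Algebra.Solver.Monoid (++-monoid B2)
    regroup : ψ α ++ (L ++ u ++ R) ++ ψ β ≡ (ψ α ++ L) ++ u ++ R ++ ψ β
    regroup = solve 5 (λ α L u R β → α ⊕ ((L ⊕ (u ⊕ R)) ⊕ β) ⊜ (α ⊕ L) ⊕ (u ⊕ (R ⊕ β))) refl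
                (ψ α) L u R (ψ β)

    open ≡-Reasoning
    decomposition : ψ (pPrefix (3 + n)) ≡ (ψ α ++ L) ++ u ++ R ++ ψ β
    decomposition = begin
      ψ (pPrefix (3 + n))                 ≡⟨ cong ψ split ⟩
      ψ (α ++ pPrefix n ++ β)             ≡⟨ ψ-++ α _ ⟩
      ψ α ++ ψ (pPrefix n ++ β)           ≡⟨ cong (ψ α ++_) (ψ-++ (pPrefix n) β) ⟩
      ψ α ++ ψ (pPrefix n) ++ ψ β         ≡⟨ cong (λ z → ψ α ++ z ++ ψ β) eq ⟩
      ψ α ++ (L ++ u ++ R) ++ ψ β         ≡⟨ regroup ⟩
      (ψ α ++ L) ++ u ++ R ++ ψ β         ∎

ψ-locate : ∀ xs l x m → ψ xs ≡ l ++ x ∷ m →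
  ∃[ X₁ ] ∃[ a ] ∃[ X₂ ] ∃[ s₁ ] ∃[ s ]
    (xs ≡ X₁ ++ a ∷ X₂ × ψ₁ a ≡ s₁ ++ x ∷ s × l ≡ ψ X₁ ++ s₁ × m ≡ s ++ ψ X₂)
ψ-locate []       []      x m ()
ψ-locate []       (_ ∷ _) x m ()
ψ-locate (c ∷ xs) l       x m eq with ++-align (ψ₁ c) (ψ xs) l (x ∷ m) eq
... | inj₁ (k , refl , k≡) with ψ-locate xs k x m k≡
...   | X₁ , a , X₂ , s₁ , s , refl , ha , refl , m≡ =
        c ∷ X₁ , a , X₂ , s₁ , s , refl , ha , sym (++-assoc (ψ₁ c) (ψ X₁) s₁) , m≡
ψ-locate (c ∷ xs) l x m eq | inj₂ (z , k , c≡ , x∷m≡) with ∷-injective x∷m≡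
... | refl , m≡ = [] , c , xs , l , k , refl , c≡ , refl , m≡

-- The index of a constructor is the position of the distinguished letter x (resp. y) in the block.
data BlockSuffix : T3 → B2 → List B2 → Set where
  s0₀ : BlockSuffix t0 b0 (b1 ∷ b1 ∷ b0 ∷ b0 ∷ b1 ∷ [])
  s0₁ : BlockSuffix t0 b1 (b1 ∷ b0 ∷ b0 ∷ b1 ∷ [])
  s0₂ : BlockSuffix t0 b1 (b0 ∷ b0 ∷ b1 ∷ [])
  s0₃ : BlockSuffix t0 b0 (b0 ∷ b1 ∷ [])
  s0₄ : BlockSuffix t0 b0 (b1 ∷ [])
  s0₅ : BlockSuffix t0 b1 []
  s1₀ : BlockSuffix t1 b0 []
  s2₀ : BlockSuffix t2 b0 (b1 ∷ b1 ∷ b0 ∷ b1 ∷ [])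
  s2₁ : BlockSuffix t2 b1 (b1 ∷ b0 ∷ b1 ∷ [])
  s2₂ : BlockSuffix t2 b1 (b0 ∷ b1 ∷ [])
  s2₃ : BlockSuffix t2 b0 (b1 ∷ [])
  s2₄ : BlockSuffix t2 b1 []

data BlockPrefix : T3 → B2 → List B2 → Set where
  p0₀ : BlockPrefix t0 b0 []
  p0₁ : BlockPrefix t0 b1 (b0 ∷ [])
  p0₂ : BlockPrefix t0 b1 (b0 ∷ b1 ∷ [])
  p0₃ : BlockPrefix t0 b0 (b0 ∷ b1 ∷ b1 ∷ [])
  p0₄ : BlockPrefix t0 b0 (b0 ∷ b1 ∷ b1 ∷ b0 ∷ [])
  p0₅ : BlockPrefix t0 b1 (b0 ∷ b1 ∷ b1 ∷ b0 ∷ b0 ∷ [])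
  p1₀ : BlockPrefix t1 b0 []
  p2₀ : BlockPrefix t2 b0 []
  p2₁ : BlockPrefix t2 b1 (b0 ∷ [])
  p2₂ : BlockPrefix t2 b1 (b0 ∷ b1 ∷ [])
  p2₃ : BlockPrefix t2 b0 (b0 ∷ b1 ∷ b1 ∷ [])
  p2₄ : BlockPrefix t2 b1 (b0 ∷ b1 ∷ b1 ∷ b0 ∷ [])

blockSuffix : ∀ {a s₁ x s} → ψ₁ a ≡ s₁ ++ x ∷ s → BlockSuffix a x s
blockSuffix {zero}          {[]}                           refl = s0₀
blockSuffix {zero}          {_ ∷ []}                       refl = s0₁
blockSuffix {zero}          {_ ∷ _ ∷ []}                   refl = s0₂
blockSuffix {zero}          {_ ∷ _ ∷ _ ∷ []}               refl = s0₃
blockSuffix {zero}          {_ ∷ _ ∷ _ ∷ _ ∷ []}           refl = s0₄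
blockSuffix {zero}          {_ ∷ _ ∷ _ ∷ _ ∷ _ ∷ []}       refl = s0₅
blockSuffix {zero}          {_ ∷ _ ∷ _ ∷ _ ∷ _ ∷ _ ∷ []}   ()
blockSuffix {zero}          {_ ∷ _ ∷ _ ∷ _ ∷ _ ∷ _ ∷ _ ∷ _} ()
blockSuffix {suc zero}      {[]}                           refl = s1₀
blockSuffix {suc zero}      {_ ∷ []}                       ()
blockSuffix {suc zero}      {_ ∷ _ ∷ _}                    ()
blockSuffix {suc (suc zero)} {[]}                          refl = s2₀
blockSuffix {suc (suc zero)} {_ ∷ []}                      refl = s2₁
blockSuffix {suc (suc zero)} {_ ∷ _ ∷ []}                  refl = s2₂
blockSuffix {suc (suc zero)} {_ ∷ _ ∷ _ ∷ []}              refl = s2₃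
blockSuffix {suc (suc zero)} {_ ∷ _ ∷ _ ∷ _ ∷ []}          refl = s2₄
blockSuffix {suc (suc zero)} {_ ∷ _ ∷ _ ∷ _ ∷ _ ∷ []}      ()
blockSuffix {suc (suc zero)} {_ ∷ _ ∷ _ ∷ _ ∷ _ ∷ _ ∷ _}   ()

blockPrefix : ∀ {b e y e₁} → ψ₁ b ≡ e ++ y ∷ e₁ → BlockPrefix b y e
blockPrefix {zero}          {[]}                           refl = p0₀
blockPrefix {zero}          {_ ∷ []}                       refl = p0₁
blockPrefix {zero}          {_ ∷ _ ∷ []}                   refl = p0₂
blockPrefix {zero}          {_ ∷ _ ∷ _ ∷ []}               refl = p0₃
blockPrefix {zero}          {_ ∷ _ ∷ _ ∷ _ ∷ []}           refl = p0₄
blockPrefix {zero}          {_ ∷ _ ∷ _ ∷ _ ∷ _ ∷ []}       refl = p0₅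
blockPrefix {zero}          {_ ∷ _ ∷ _ ∷ _ ∷ _ ∷ _ ∷ []}   ()
blockPrefix {zero}          {_ ∷ _ ∷ _ ∷ _ ∷ _ ∷ _ ∷ _ ∷ _} ()
blockPrefix {suc zero}      {[]}                           refl = p1₀
blockPrefix {suc zero}      {_ ∷ []}                       ()
blockPrefix {suc zero}      {_ ∷ _ ∷ _}                    ()
blockPrefix {suc (suc zero)} {[]}                          refl = p2₀
blockPrefix {suc (suc zero)} {_ ∷ []}                      refl = p2₁
blockPrefix {suc (suc zero)} {_ ∷ _ ∷ []}                  refl = p2₂
blockPrefix {suc (suc zero)} {_ ∷ _ ∷ _ ∷ []}              refl = p2₃
blockPrefix {suc (suc zero)} {_ ∷ _ ∷ _ ∷ _ ∷ []}          refl = p2₄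
blockPrefix {suc (suc zero)} {_ ∷ _ ∷ _ ∷ _ ∷ _ ∷ []}      ()
blockPrefix {suc (suc zero)} {_ ∷ _ ∷ _ ∷ _ ∷ _ ∷ _ ∷ _}   ()

-- The proper prefixes of blocks are exactly the prefixes of 01100.
data ProperPrefix : List B2 → Set where
  pp-ε     : ProperPrefix []
  pp-0     : ProperPrefix (b0 ∷ [])
  pp-01    : ProperPrefix (b0 ∷ b1 ∷ [])
  pp-011   : ProperPrefix (b0 ∷ b1 ∷ b1 ∷ [])
  pp-0110  : ProperPrefix (b0 ∷ b1 ∷ b1 ∷ b0 ∷ [])
  pp-01100 : ProperPrefix (b0 ∷ b1 ∷ b1 ∷ b0 ∷ b0 ∷ [])

BlockPrefix⇒ProperPrefix : ∀ {b y e} → BlockPrefix b y e → ProperPrefix e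
BlockPrefix⇒ProperPrefix p0₀ = pp-ε
BlockPrefix⇒ProperPrefix p0₁ = pp-0
BlockPrefix⇒ProperPrefix p0₂ = pp-01
BlockPrefix⇒ProperPrefix p0₃ = pp-011
BlockPrefix⇒ProperPrefix p0₄ = pp-0110
BlockPrefix⇒ProperPrefix p0₅ = pp-01100
BlockPrefix⇒ProperPrefix p1₀ = pp-ε
BlockPrefix⇒ProperPrefix p2₀ = pp-ε
BlockPrefix⇒ProperPrefix p2₁ = pp-0
BlockPrefix⇒ProperPrefix p2₂ = pp-01
BlockPrefix⇒ProperPrefix p2₃ = pp-011
BlockPrefix⇒ProperPrefix p2₄ = pp-0110

marker∷-∉-block : ∀ a c → ¬ Factor (w11001 ++ [ c ]) (ψ₁ a) × ¬ Factor (w1101 ++ [ c ]) (ψ₁ a)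
marker∷-∉-block zero            zero       = notFactor _ _ , notFactor _ _
marker∷-∉-block zero            (suc zero) = notFactor _ _ , notFactor _ _
marker∷-∉-block (suc zero)      zero       = notFactor _ _ , notFactor _ _
marker∷-∉-block (suc zero)      (suc zero) = notFactor _ _ , notFactor _ _
marker∷-∉-block (suc (suc zero)) zero      = notFactor _ _ , notFactor _ _
marker∷-∉-block (suc (suc zero)) (suc zero) = notFactor _ _ , notFactor _ _

inside-block-markerFree : ∀ a s₁ x v z k → ψ₁ a ≡ s₁ ++ x ∷ v ++ z ∷ k → ¬ MarkerIn v
inside-block-markerFree a s₁ x v z k eq =
  [ extended (λ c → proj₁ (marker∷-∉-block a c)) , extended (λ c → proj₂ (marker∷-∉-block a c)) ]′
  where
    v∷-in-block : Factor (v ++ z ∷ k) (ψ₁ a)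
    v∷-in-block = subst (Factor _) (trans (∷ʳ-++ s₁ x _) (sym eq)) (Factor-suffix (s₁ ∷ʳ x) _)

    extended : ∀ {M} → (∀ c → ¬ Factor (M ++ [ c ]) (ψ₁ a)) → ¬ Factor M v
    extended M∷-∉-block f with Factor-extendʳ z k f
    ... | c , f′ = M∷-∉-block c (Factor-trans f′ v∷-in-block)

-- An occurrence x v y inside ψ(a w b): x lies in the block ψ(a), y in ψ(b), and v = s ψ(w) e.
record Occurrence (v : List B2) (x y : B2) : Set where
  constructor occ
  field
    a       : T3
    w       : List T3
    b       : T3
    s e     : List B2
    context : Lp (a ∷ w ++ [ b ])
    suffix  : BlockSuffix a x s
    prefix  : BlockPrefix b y e
    parse   : v ≡ s ++ ψ w ++ e

module Occ = Occurrence

occurrence : ∀ {xs l x v y r} → Lp xs → ψ xs ≡ l ++ x ∷ v ++ y ∷ r → MarkerIn v → Occurrence v x y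
occurrence {xs} {l} {x} {v} {y} {r} lxs eq m with ψ-locate xs l x (v ++ y ∷ r) eq
... | X₁ , a , X₂ , s₁ , s , refl , ha , _ , hm with ++-align s (ψ X₂) v (y ∷ r) (sym hm)
...   | inj₂ (z , k , s≡ , _) =
        ⊥-elim (inside-block-markerFree a s₁ x v z k (trans ha (cong (λ t → s₁ ++ x ∷ t) s≡)) m)
...   | inj₁ (k , v≡ , k≡) with ψ-locate X₂ k y r k≡
...     | W , b , X₃ , e , _ , refl , hb , refl , _ =
          occ a W b s e context (blockSuffix ha) (blockPrefix hb) v≡
  where
    context : Lp (a ∷ W ++ [ b ])
    context = Lp-factor (X₁ , X₃ , cong (λ t → X₁ ++ a ∷ t) (sym (++-assoc W [ b ] X₃))) lxs

leftOccurrence : ∀ {x v} → Lψp (x ∷ v) → MarkerIn v → ∃[ y ] Occurrence v x y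
leftOccurrence h m with Lψp-flanked h
... | xs , lxs , l , c , d , r , eq = d , occurrence lxs (trans eq (sym (∷ʳ-++ l c _))) m

rightOccurrence : ∀ {y v} → Lψp (v ++ [ y ]) → MarkerIn v → ∃[ x ] Occurrence v x y
rightOccurrence {y} {v} h m with Lψp-flanked h
... | xs , lxs , l , c , d , r , eq =
      c , occurrence lxs (trans eq (cong (λ t → l ++ c ∷ t) (++-assoc v [ y ] _))) m

ParsedPrefix : List B2 → Set
ParsedPrefix R = ∃[ w ] ∃[ e ] (ProperPrefix e × ψ w ++ e ≡ R)

parsed : ∀ {b y e} w → BlockPrefix b y e → ParsedPrefix (ψ w ++ e)
parsed w p = w , _ , BlockPrefix⇒ProperPrefix p , refl

no-leading-1 : ∀ {zs} → ¬ ParsedPrefix (b1 ∷ zs)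
no-leading-1 ([] , _ , pp-ε , ())
no-leading-1 ([] , _ , pp-0 , ())
no-leading-1 ([] , _ , pp-01 , ())
no-leading-1 ([] , _ , pp-011 , ())
no-leading-1 ([] , _ , pp-0110 , ())
no-leading-1 ([] , _ , pp-01100 , ())
no-leading-1 (zero ∷ _ , _ , _ , ())
no-leading-1 (suc zero ∷ _ , _ , _ , ())
no-leading-1 (suc (suc zero) ∷ _ , _ , _ , ())

after-01 : ∀ {R} → ParsedPrefix (b0 ∷ b1 ∷ R) → ParsedPrefix R → R ≡ []
after-01 ([] , _ , pp-ε , ())    _
after-01 ([] , _ , pp-0 , ())    _
after-01 ([] , _ , pp-01 , refl) _  = refl
after-01 ([] , _ , pp-011 , refl)   pR = ⊥-elim (no-leading-1 pR)
after-01 ([] , _ , pp-0110 , refl)  pR = ⊥-elim (no-leading-1 pR)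
after-01 ([] , _ , pp-01100 , refl) pR = ⊥-elim (no-leading-1 pR)
after-01 (zero ∷ _ , _ , _ , refl)  pR = ⊥-elim (no-leading-1 pR)
after-01 (suc zero ∷ w , e , p , eq) _ = ⊥-elim (no-leading-1 (w , e , p , ∷-injectiveʳ eq))
after-01 (suc (suc zero) ∷ _ , _ , _ , refl) pR = ⊥-elim (no-leading-1 pR)

after-001 : ∀ {R} → ParsedPrefix (b0 ∷ b0 ∷ b1 ∷ R) → ParsedPrefix R → R ≡ []
after-001 ([] , _ , pp-ε , ())     _
after-001 ([] , _ , pp-0 , ())     _
after-001 ([] , _ , pp-01 , ())    _
after-001 ([] , _ , pp-011 , ())   _
after-001 ([] , _ , pp-0110 , ())  _
after-001 ([] , _ , pp-01100 , ()) _
after-001 (zero ∷ _ , _ , _ , ())  _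
after-001 (suc zero ∷ w , e , p , eq) pR = after-01 (w , e , p , ∷-injectiveʳ eq) pR
after-001 (suc (suc zero) ∷ _ , _ , _ , ()) _

BlockSuffix-tail : ∀ {a x c s} → BlockSuffix a x (c ∷ s) → BlockSuffix a c s
BlockSuffix-tail s0₀ = s0₁
BlockSuffix-tail s0₁ = s0₂
BlockSuffix-tail s0₂ = s0₃
BlockSuffix-tail s0₃ = s0₄
BlockSuffix-tail s0₄ = s0₅
BlockSuffix-tail s2₀ = s2₁
BlockSuffix-tail s2₁ = s2₂
BlockSuffix-tail s2₂ = s2₃
BlockSuffix-tail s2₃ = s2₄

data Overhang : List B2 → Set where
  oh-01  : Overhang (b0 ∷ b1 ∷ [])
  oh-001 : Overhang (b0 ∷ b0 ∷ b1 ∷ [])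

overhang : ∀ {a x c t R} → BlockSuffix a x (c ∷ t) → ParsedPrefix (c ∷ t ++ R) → ParsedPrefix R →
  Overhang (c ∷ t) × R ≡ []
overhang s0₀ p _  = ⊥-elim (no-leading-1 p)
overhang s0₁ p _  = ⊥-elim (no-leading-1 p)
overhang s0₂ p pR = oh-001 , after-001 p pR
overhang s0₃ p pR = oh-01 , after-01 p pR
overhang s0₄ p _  = ⊥-elim (no-leading-1 p)
overhang s2₀ p _  = ⊥-elim (no-leading-1 p)
overhang s2₁ p _  = ⊥-elim (no-leading-1 p)
overhang s2₂ p pR = oh-01 , after-01 p pR
overhang s2₃ p _  = ⊥-elim (no-leading-1 p)

Overshoot : List B2 → List B2 → List B2 → Set
Overshoot s s′ R′ = ∃[ T ] (Overhang T × s′ ≡ s ++ T × R′ ≡ [])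

-- Both cuts are advanced in lockstep; when one runs out, the other still has to cover the
-- beginning of a parsed prefix, which a block suffix can only do with 01 or 001 and nothing after.
cuts-agree : ∀ {a x s a′ x′ s′ R R′} → BlockSuffix a x s → BlockSuffix a′ x′ s′ →
  ParsedPrefix R → ParsedPrefix R′ → s ++ R ≡ s′ ++ R′ →
  s ≡ s′ ⊎ (Overshoot s s′ R′ ⊎ Overshoot s′ s R)
cuts-agree {s = []}    {s′ = []}      _   _    _  _   _    = inj₁ refl
cuts-agree {s = []}    {s′ = c ∷ t}   _   suf′ pR pR′ refl with overhang suf′ pR pR′
... | oh , R′≡[] = inj₂ (inj₁ (c ∷ t , oh , refl , R′≡[]))
cuts-agree {s = c ∷ t} {s′ = []}      suf _    pR pR′ refl with overhang suf pR′ pR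
... | oh , R≡[] = inj₂ (inj₂ (c ∷ t , oh , refl , R≡[]))
cuts-agree {s = c ∷ t} {s′ = _ ∷ t′}  suf suf′ pR pR′ eq with ∷-injective eq
... | refl , eq′ with cuts-agree (BlockSuffix-tail suf) (BlockSuffix-tail suf′) pR pR′ eq′
...   | inj₁ refl                          = inj₁ refl
...   | inj₂ (inj₁ (T , oh , refl , R′≡[])) = inj₂ (inj₁ (T , oh , refl , R′≡[]))
...   | inj₂ (inj₂ (T , oh , refl , R≡[]))  = inj₂ (inj₂ (T , oh , refl , R≡[]))

overshoot-markerFree : ∀ {a x s a′ x′ T} → BlockSuffix a x s → Overhang T →
  BlockSuffix a′ x′ (s ++ T) → ¬ MarkerIn (s ++ T)
overshoot-markerFree s0₀ oh-01  ()
overshoot-markerFree s0₀ oh-001 ()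
overshoot-markerFree s0₁ oh-01  ()
overshoot-markerFree s0₁ oh-001 ()
overshoot-markerFree s0₂ oh-01  ()
overshoot-markerFree s0₂ oh-001 ()
overshoot-markerFree s0₃ oh-01  ()
overshoot-markerFree s0₃ oh-001 ()
overshoot-markerFree s0₄ oh-01  _ = markerFree _
overshoot-markerFree s0₄ oh-001 _ = markerFree _
overshoot-markerFree s0₅ oh-01  _ = markerFree _
overshoot-markerFree s0₅ oh-001 _ = markerFree _
overshoot-markerFree s1₀ oh-01  _ = markerFree _
overshoot-markerFree s1₀ oh-001 _ = markerFree _
overshoot-markerFree s2₀ oh-01  ()
overshoot-markerFree s2₀ oh-001 ()
overshoot-markerFree s2₁ oh-01  ()
overshoot-markerFree s2₁ oh-001 ()
overshoot-markerFree s2₂ oh-01  ()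
overshoot-markerFree s2₂ oh-001 ()
overshoot-markerFree s2₃ oh-01  _ = markerFree _
overshoot-markerFree s2₃ oh-001 _ = markerFree _
overshoot-markerFree s2₄ oh-01  _ = markerFree _
overshoot-markerFree s2₄ oh-001 _ = markerFree _

-- ψ(1) = 0 is a proper prefix of a block, which is the only source of ambiguity.
data Reparse : List T3 → List B2 → List T3 → List B2 → Set where
  same    : ∀ {w e} → Reparse w e w e
  absorbˡ : ∀ {w} → Reparse (w ++ [ t1 ]) [] w w0
  absorbʳ : ∀ {w} → Reparse w w0 (w ++ [ t1 ]) []

Reparse-∷ : ∀ c {w e w′ e′} → Reparse w e w′ e′ → Reparse (c ∷ w) e (c ∷ w′) e′
Reparse-∷ c same    = same
Reparse-∷ c absorbˡ = absorbˡ
Reparse-∷ c absorbʳ = absorbʳ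

block-in-properPrefix : ∀ {c w e e′} → ProperPrefix e → ProperPrefix e′ → ψ (c ∷ w) ++ e′ ≡ e →
  c ≡ t1 × w ≡ [] × e′ ≡ [] × e ≡ w0
block-in-properPrefix {suc zero} {w} {e′ = e′} pp-0 _ eq with ψ-++-≡[] w e′ (∷-injectiveʳ eq)
... | refl , refl = refl , refl , refl , refl
block-in-properPrefix {suc zero} pp-ε     _  ()
block-in-properPrefix {suc zero} {w} pp-01    p′ eq = ⊥-elim (no-leading-1 (w , _ , p′ , ∷-injectiveʳ eq))
block-in-properPrefix {suc zero} {w} pp-011   p′ eq = ⊥-elim (no-leading-1 (w , _ , p′ , ∷-injectiveʳ eq))
block-in-properPrefix {suc zero} {w} pp-0110  p′ eq = ⊥-elim (no-leading-1 (w , _ , p′ , ∷-injectiveʳ eq))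
block-in-properPrefix {suc zero} {w} pp-01100 p′ eq = ⊥-elim (no-leading-1 (w , _ , p′ , ∷-injectiveʳ eq))
block-in-properPrefix {zero} pp-ε     _ ()
block-in-properPrefix {zero} pp-0     _ ()
block-in-properPrefix {zero} pp-01    _ ()
block-in-properPrefix {zero} pp-011   _ ()
block-in-properPrefix {zero} pp-0110  _ ()
block-in-properPrefix {zero} pp-01100 _ ()
block-in-properPrefix {suc (suc zero)} pp-ε     _ ()
block-in-properPrefix {suc (suc zero)} pp-0     _ ()
block-in-properPrefix {suc (suc zero)} pp-01    _ ()
block-in-properPrefix {suc (suc zero)} pp-011   _ ()
block-in-properPrefix {suc (suc zero)} pp-0110  _ ()
block-in-properPrefix {suc (suc zero)} pp-01100 _ ()

first-block : ∀ {c c′ X X′} → ParsedPrefix X → ParsedPrefix X′ → ψ₁ c ++ X ≡ ψ₁ c′ ++ X′ → c ≡ c′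
first-block {zero}          {zero}          _ _ _ = refl
first-block {suc zero}      {suc zero}      _ _ _ = refl
first-block {suc (suc zero)} {suc (suc zero)} _ _ _ = refl
first-block {zero}          {suc (suc zero)} _ _ ()
first-block {suc (suc zero)} {zero}          _ _ ()
first-block {suc zero}      {zero}          pX _ eq =
  ⊥-elim (no-leading-1 (subst ParsedPrefix (∷-injectiveʳ eq) pX))
first-block {suc zero}      {suc (suc zero)} pX _ eq =
  ⊥-elim (no-leading-1 (subst ParsedPrefix (∷-injectiveʳ eq) pX))
first-block {zero}          {suc zero}      _ pX′ eq =
  ⊥-elim (no-leading-1 (subst ParsedPrefix (sym (∷-injectiveʳ eq)) pX′))
first-block {suc (suc zero)} {suc zero}     _ pX′ eq =
  ⊥-elim (no-leading-1 (subst ParsedPrefix (sym (∷-injectiveʳ eq)) pX′))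

reparse : ∀ w e w′ e′ → ProperPrefix e → ProperPrefix e′ → ψ w ++ e ≡ ψ w′ ++ e′ → Reparse w e w′ e′
reparse []      e []        e′ _ _  refl = same
reparse []      e (c ∷ w′)  e′ p p′ eq with block-in-properPrefix {c} {w′} p p′ (sym eq)
... | refl , refl , refl , refl = absorbʳ
reparse (c ∷ w) e []        e′ p p′ eq with block-in-properPrefix {c} {w} p′ p eq
... | refl , refl , refl , refl = absorbˡ
reparse (c ∷ w) e (c′ ∷ w′) e′ p p′ eq =
  step (trans (sym (++-assoc (ψ₁ c) (ψ w) e)) (trans eq (++-assoc (ψ₁ c′) (ψ w′) e′)))
  where
    step : ψ₁ c ++ ψ w ++ e ≡ ψ₁ c′ ++ ψ w′ ++ e′ → Reparse (c ∷ w) e (c′ ∷ w′) e′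
    step eq′ with first-block {c} {c′} (w , e , p , refl) (w′ , e′ , p′ , refl) eq′
    ... | refl = Reparse-∷ c (reparse w e w′ e′ p p′ (++-cancelˡ (ψ₁ c) _ _ eq′))

≡-++-[] : ∀ {A : Set} {v s R : List A} → v ≡ s ++ R → R ≡ [] → v ≡ s
≡-++-[] {s = s} v≡ refl = trans v≡ (++-identityʳ s)

realign : ∀ {v x y x′ y′} → MarkerIn v → (o : Occurrence v x y) (o′ : Occurrence v x′ y′) →
  Occ.s o ≡ Occ.s o′ × Reparse (Occ.w o) (Occ.e o) (Occ.w o′) (Occ.e o′)
realign m (occ _ w _ s e _ suf pre refl) (occ _ w′ _ s′ e′ _ suf′ pre′ eq)
  with cuts-agree suf suf′ (parsed w pre) (parsed w′ pre′) eq
... | inj₁ refl =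
      refl , reparse w e w′ e′ (BlockPrefix⇒ProperPrefix pre) (BlockPrefix⇒ProperPrefix pre′)
                     (++-cancelˡ s _ _ eq)
... | inj₂ (inj₁ (_ , oh , refl , R′≡[])) =
      ⊥-elim (overshoot-markerFree suf oh suf′ (subst MarkerIn (≡-++-[] eq R′≡[]) m))
... | inj₂ (inj₂ (_ , oh , refl , R≡[])) =
      ⊥-elim (overshoot-markerFree suf′ oh suf (subst MarkerIn (≡-++-[] refl R≡[]) m))

data TwoFactor : T3 → T3 → Set where
  a01 : TwoFactor t0 t1
  a02 : TwoFactor t0 t2
  a10 : TwoFactor t1 t0
  a12 : TwoFactor t1 t2
  a21 : TwoFactor t2 t1

φ-Linked : ∀ {u} → Linked TwoFactor u → Linked TwoFactor (φ u)
φ-Linked {[]}                  _ = []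
φ-Linked {zero ∷ []}           _ = a01 ∷ [-]
φ-Linked {suc zero ∷ []}       _ = a21 ∷ [-]
φ-Linked {suc (suc zero) ∷ []} _ = [-]
φ-Linked (a01 ∷ h) = a01 ∷ a12 ∷ φ-Linked h
φ-Linked (a02 ∷ h) = a01 ∷ a10 ∷ φ-Linked h
φ-Linked (a10 ∷ h) = a21 ∷ a10 ∷ φ-Linked h
φ-Linked (a12 ∷ h) = a21 ∷ a10 ∷ φ-Linked h
φ-Linked (a21 ∷ h) = a02 ∷ φ-Linked h

pPrefix-Linked : ∀ n → Linked TwoFactor (pPrefix n)
pPrefix-Linked zero    = [-]
pPrefix-Linked (suc n) = φ-Linked (pPrefix-Linked n)

Linked-infix : ∀ {A : Set} {R : A → A → Set} (l : List A) {x y} r → Linked R (l ++ x ∷ y ∷ r) → R x y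
Linked-infix []      r h = head h
Linked-infix (_ ∷ l) r h = Linked-infix l r (tail h)

Lp-pair : ∀ {x y} → Lp (x ∷ y ∷ []) → TwoFactor x y
Lp-pair (n , l , r , eq) = Linked-infix l r (subst (Linked TwoFactor) eq (pPrefix-Linked n))

no-common-successor-1-2 : ∀ {w} → w ≢ [] → Lp (t1 ∷ w) → Lp (t2 ∷ w) → ⊥
no-common-successor-1-2 {[]}    w≢[] _ _ = w≢[] refl
no-common-successor-1-2 {c ∷ w} _ l₁ l₂
  with Lp-pair (Lp-prefix (t1 ∷ c ∷ []) w l₁) | Lp-pair (Lp-prefix (t2 ∷ c ∷ []) w l₂)
... | a10 | ()
... | a12 | ()

no-common-predecessor-0-1 : ∀ {w} → w ≢ [] → Lp (w ++ [ t0 ]) → Lp (w ++ [ t1 ]) → ⊥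
no-common-predecessor-0-1 {w} w≢[] l₀ l₁ with initLast w
... | []      = w≢[] refl
... | u ∷ʳ′ z with Lp-pair (last-pair l₀) | Lp-pair (last-pair l₁)
  where
    last-pair : ∀ {y} → Lp ((u ∷ʳ z) ++ [ y ]) → Lp (z ∷ y ∷ [])
    last-pair l = Lp-suffix u _ (subst Lp (++-assoc u [ z ] _) l)
...   | a10 | ()

-- a₀ and a₁ are the blocks containing the 0 of 0v and the 1 of 1v, and s is the common cut.
data LeftCut : T3 → T3 → List B2 → Set where
  after-1-0 : LeftCut t1 t0 []
  after-1-2 : LeftCut t1 t2 []
  after-0-2 : LeftCut t0 t2 w01

leftCut : ∀ {a₀ a₁ s} → BlockSuffix a₀ b0 s → BlockSuffix a₁ b1 s → LeftCut a₀ a₁ s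
leftCut s1₀ s0₅ = after-1-0
leftCut s1₀ s2₄ = after-1-2
leftCut s0₃ s2₂ = after-0-2

-- The parse of v0 has middle w₂, that of v1 is (w, e); b₂ and b₃ are the blocks containing the 0
-- of v0 and the 1 of v1.
data RightCut : List T3 → List T3 → T3 → T3 → List B2 → Set where
  before-0-2   : ∀ {w}   → RightCut w w t0 t2 w0110
  before-any-0 : ∀ {w b} → RightCut (w ++ [ t1 ]) w b t0 w0
  before-any-2 : ∀ {w b} → RightCut (w ++ [ t1 ]) w b t2 w0

rightCut : ∀ {w₂ e₂ w e b₂ b₃} → Reparse w₂ e₂ w e → BlockPrefix b₂ b0 e₂ → BlockPrefix b₃ b1 e →
  RightCut w₂ w b₂ b₃ e
rightCut same    p0₄ p2₄ = before-0-2
rightCut absorbˡ _   p0₁ = before-any-0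
rightCut absorbˡ _   p2₁ = before-any-2
rightCut absorbʳ _   ()

rightCut-≢[] : ∀ {w₂ w b₂ b₃ e} → RightCut w₂ w b₂ b₃ e → e ≢ []
rightCut-≢[] before-0-2   ()
rightCut-≢[] before-any-0 ()
rightCut-≢[] before-any-2 ()

middle-nonempty : ∀ {a₀ a₁ s w₂ w b₂ b₃ e} → LeftCut a₀ a₁ s → RightCut w₂ w b₂ b₃ e →
  MarkerIn (s ++ ψ w ++ e) → w ≢ []
middle-nonempty after-1-0 before-0-2   m refl = markerFree _ m
middle-nonempty after-1-0 before-any-0 m refl = markerFree _ m
middle-nonempty after-1-0 before-any-2 m refl = markerFree _ m
middle-nonempty after-1-2 before-0-2   m refl = markerFree _ m
middle-nonempty after-1-2 before-any-0 m refl = markerFree _ m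
middle-nonempty after-1-2 before-any-2 m refl = markerFree _ m
middle-nonempty after-0-2 before-0-2   m refl = markerFree _ m
middle-nonempty after-0-2 before-any-0 m refl = markerFree _ m
middle-nonempty after-0-2 before-any-2 m refl = markerFree _ m

leftContext : ∀ {a w′ e′ b w e} → Reparse w′ e′ w e → e ≢ [] → Lp (a ∷ w′ ++ [ b ]) → Lp (a ∷ w)
leftContext {a} {b = b} {w} same    _ lp = Lp-prefix (a ∷ w) [ b ] lp
leftContext {a} {b = b} {w} absorbˡ _ lp =
  Lp-prefix (a ∷ w) (t1 ∷ b ∷ []) (subst Lp (cong (a ∷_) (++-assoc w [ t1 ] [ b ])) lp)
leftContext absorbʳ e≢[] _ = ⊥-elim (e≢[] refl)

data LeftCase (w : List T3) : List B2 → Set where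
  left-0-1 : Lp (t0 ∷ w) → Lp (t1 ∷ w) → LeftCase w []
  left-0-2 : Lp (t0 ∷ w) → Lp (t2 ∷ w) → LeftCase w w01

data RightCase (w : List T3) : List B2 → Set where
  right-0-2 : Lp (w ++ [ t0 ]) → Lp (w ++ [ t2 ]) → RightCase w w0110
  right-1-2 : Lp (w ++ [ t1 ]) → Lp (w ++ [ t2 ]) → RightCase w w0

leftCase : ∀ {a₀ a₁ s w} → LeftCut a₀ a₁ s → w ≢ [] → Lp (a₀ ∷ w) → Lp (a₁ ∷ w) → LeftCase w s
leftCase after-1-0 _    l₁ l₀ = left-0-1 l₀ l₁
leftCase after-1-2 w≢[] l₁ l₂ = ⊥-elim (no-common-successor-1-2 w≢[] l₁ l₂)
leftCase after-0-2 _    l₀ l₂ = left-0-2 l₀ l₂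

rightCase : ∀ {a₂ a₃ w₂ w b₂ b₃ e} → RightCut w₂ w b₂ b₃ e → w ≢ [] →
  Lp (a₂ ∷ w₂ ++ [ b₂ ]) → Lp (a₃ ∷ w ++ [ b₃ ]) → RightCase w e
rightCase {a₂} {a₃} before-0-2 _ l₂ l₃ = right-0-2 (Lp-suffix [ a₂ ] _ l₂) (Lp-suffix [ a₃ ] _ l₃)
rightCase {a₂} {a₃} {w = w} {b₂ = b₂} before-any-0 w≢[] l₂ l₃ =
  ⊥-elim (no-common-predecessor-0-1 w≢[] (Lp-suffix [ a₃ ] _ l₃)
           (Lp-prefix (w ++ [ t1 ]) [ b₂ ] (Lp-suffix [ a₂ ] _ l₂)))
rightCase {a₂} {a₃} {w = w} {b₂ = b₂} before-any-2 _ l₂ l₃ =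
  right-1-2 (Lp-prefix (w ++ [ t1 ]) [ b₂ ] (Lp-suffix [ a₂ ] _ l₂)) (Lp-suffix [ a₃ ] _ l₃)

Classification : List B2 → Set
Classification v =
  (∃[ w ] (Lp w × v ≡ w01 ++ ψ w ++ w0110 ×
      Lp (t0 ∷ w) × Lp (t2 ∷ w) × Lp (w ++ [ t0 ]) × Lp (w ++ [ t2 ])))
  ⊎ (∃[ w ] (Lp w × v ≡ ψ w ++ w0 ×
      Lp (t0 ∷ w) × Lp (t1 ∷ w) × Lp (w ++ [ t1 ]) × Lp (w ++ [ t2 ])))
  ⊎ (∃[ w ] (Lp w × v ≡ w01 ++ ψ w ++ w0 ×
      Lp (t0 ∷ w) × Lp (t2 ∷ w) × Lp (w ++ [ t1 ]) × Lp (w ++ [ t2 ])))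
  ⊎ (∃[ w ] (Lp w × v ≡ ψ w ++ w0110 ×
      Lp (t0 ∷ w) × Lp (t1 ∷ w) × Lp (w ++ [ t0 ]) × Lp (w ++ [ t2 ])))

classify : ∀ {v s w e} → v ≡ s ++ ψ w ++ e → LeftCase w s → RightCase w e → Classification v
classify {w = w} v≡ (left-0-2 l₀ l₂) (right-0-2 r₀ r₂) =
  inj₁ (w , Lp-suffix [ t0 ] w l₀ , v≡ , l₀ , l₂ , r₀ , r₂)
classify {w = w} v≡ (left-0-1 l₀ l₁) (right-1-2 r₁ r₂) =
  inj₂ (inj₁ (w , Lp-suffix [ t0 ] w l₀ , v≡ , l₀ , l₁ , r₁ , r₂))
classify {w = w} v≡ (left-0-2 l₀ l₂) (right-1-2 r₁ r₂) =
  inj₂ (inj₂ (inj₁ (w , Lp-suffix [ t0 ] w l₀ , v≡ , l₀ , l₂ , r₁ , r₂)))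
classify {w = w} v≡ (left-0-1 l₀ l₁) (right-0-2 r₀ r₂) =
  inj₂ (inj₂ (inj₂ (w , Lp-suffix [ t0 ] w l₀ , v≡ , l₀ , l₁ , r₀ , r₂)))

bispecial-classification : ∀ {v y₀ y₁ x₂ x₃} → MarkerIn v →
  Occurrence v b0 y₀ → Occurrence v b1 y₁ → Occurrence v x₂ b0 → Occurrence v x₃ b1 → Classification v
bispecial-classification m o₀@(occ a₀ _ _ _ _ ctx₀ suf₀ _ _) o₁@(occ a₁ _ _ _ _ ctx₁ suf₁ _ _)
                           o₂@(occ _ w₂ b₂ _ _ ctx₂ _ pre₂ _) o₃@(occ _ w b₃ s e ctx₃ _ pre₃ parse)
  with realign m o₀ o₃ | realign m o₁ o₃ | realign m o₂ o₃
... | refl , ρ₀ | refl , ρ₁ | refl , ρ₂ =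
  classify parse (leftCase lcut w≢[] (leftContext ρ₀ e≢[] ctx₀) (leftContext ρ₁ e≢[] ctx₁))
                 (rightCase rcut w≢[] ctx₂ ctx₃)
  where
    lcut : LeftCut a₀ a₁ s
    lcut = leftCut suf₀ suf₁

    rcut : RightCut w₂ w b₂ b₃ e
    rcut = rightCut ρ₂ pre₂ pre₃

    e≢[] : e ≢ []
    e≢[] = rightCut-≢[] rcut

    w≢[] : w ≢ []
    w≢[] = middle-nonempty lcut rcut (subst MarkerIn parse m)

both-letters : (P : B2 → Set) {x y : B2} → x ≢ y → P x → P y → P b0 × P b1
both-letters P {zero}     {zero}     x≢y _  _  = ⊥-elim (x≢y refl)
both-letters P {zero}     {suc zero} _   px py = px , py
both-letters P {suc zero} {zero}     _   px py = py , px
both-letters P {suc zero} {suc zero} x≢y _  _  = ⊥-elim (x≢y refl)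

mainTheorem8 : (v : List B2) → Lψp v → BispecialΨp v →
    (Factor w11001 v ⊎ Factor w1101 v) →
    (∃[ w ] (Lp w × v ≡ w01 ++ ψ w ++ w0110 ×
        Lp (t0 ∷ w) × Lp (t2 ∷ w) × Lp (w ++ [ t0 ]) × Lp (w ++ [ t2 ])))
    ⊎ (∃[ w ] (Lp w × v ≡ ψ w ++ w0 ×
        Lp (t0 ∷ w) × Lp (t1 ∷ w) × Lp (w ++ [ t1 ]) × Lp (w ++ [ t2 ])))
    ⊎ (∃[ w ] (Lp w × v ≡ w01 ++ ψ w ++ w0 ×
        Lp (t0 ∷ w) × Lp (t2 ∷ w) × Lp (w ++ [ t1 ]) × Lp (w ++ [ t2 ])))
    ⊎ (∃[ w ] (Lp w × v ≡ ψ w ++ w0110 ×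
        Lp (t0 ∷ w) × Lp (t1 ∷ w) × Lp (w ++ [ t0 ]) × Lp (w ++ [ t2 ])))
mainTheorem8 v _ ((_ , _ , x≢x′ , lx , lx′) , (_ , _ , y≢y′ , ry , ry′)) m
  with both-letters (λ c → Lψp (c ∷ v)) x≢x′ lx lx′ | both-letters (λ c → Lψp (v ++ [ c ])) y≢y′ ry ry′
... | l₀ , l₁ | r₀ , r₁ =
  bispecial-classification m (proj₂ (leftOccurrence l₀ m)) (proj₂ (leftOccurrence l₁ m))
                             (proj₂ (rightOccurrence r₀ m)) (proj₂ (rightOccurrence r₁ m))
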